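{- Let $p$ be a prime and let $F_p(n)$ denote the number of binomial coefficients $\binom{m}{k}$ with $0\le k\le m<n$ that are not divisible by $p$ (so $F_p(0)=0$). Then $F_p(j)=\binom{j+1}{2}$ for $j=1,\dots,p-1$, and $$F_p(n)=\sum_{0\le j<p}(p-j)\,F_p\!\left(\left\lfloor\frac{n+j}{p}\right\rfloor\right)$$ holds for all $n\ge p$; in fact it holds for all $n\ge0$. -}

module Defs where

open import Data.Nat using (ℕ; zero; suc; _+_; _*_; _∸_; _/_)
open import Data.Nat.Divisibility using (_∣?_)
open import Data.Nat.Combinatorics using (_C_)
open import Data.Bool using (if_then_else_)
open import Relation.Nullary.Decidable using (does)


countNonDiv : ℕ → (ℕ → ℕ) → ℕ → ℕ
countNonDiv p f zero    = 0
countNonDiv p f (suc n) =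
  countNonDiv p f n + (if does (p ∣? f n) then 0 else 1)

F : ℕ → ℕ → ℕ
F p zero    = 0
F p (suc m) = F p m + countNonDiv p (λ k → m C k) (suc m)

sumBelow : ℕ → (ℕ → ℕ) → ℕ
sumBelow zero    f = 0
sumBelow (suc n) f = sumBelow n f + f n

{-# OPTIONS --safe #-}
-- Lucas' theorem, proved digitwise from Pascal's rule, says that for r, s < p the binomial
-- coefficient C(r + a p, s + c p) is congruent to C(a, c) C(r, s) modulo p. Hence row r + a p of
-- Pascal's triangle has r + 1 times as many entries prime to p as row a, that is
-- F(n + 1) − F(n) = (n mod p + 1) N(⌊n / p⌋) with N(m) the number of such entries in row m.
-- On the right-hand side, F(⌊(n + j) / p⌋) moves with n only for the unique j < p such that
-- p ∣ n + j + 1, namely j = p − 1 − n mod p, and then by N(⌊n / p⌋) with weight p − j = n mod p + 1.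
-- So both sides obey the same recurrence from the common value 0 at n = 0. Rows below p have no
-- entry divisible by p, which gives F(j) = 1 + 2 + ⋯ + j for j ≤ p.
module Submission where

open import Defs
open import Data.Nat using (ℕ; suc; NonZero; _+_; _*_; _∸_; _/_; _≤_; _<_)
open import Data.Nat.Primality using (Prime)
open import Data.Nat.Combinatorics using (_C_)
open import Data.Product using (_×_)
open import Relation.Binary.PropositionalEquality using (_≡_)

open import Data.Nat using (zero; _%_; _!; _≤′_; ≤′-refl; ≤′-step; z≤n; s≤s)
open import Data.Nat.Properties
open import Data.Nat.DivMod
  using (m≡m%n+[m/n]*n; %-distribˡ-+; +-distrib-/-∣ʳ; m<n⇒m/n≡0; m*n/n≡m; m/n*n≡m; m%n<n)
open import Data.Nat.Divisibility
  using (_∣_; divides; _∣?_; _∣0; ∣-refl; ∣⇒≤; ∣1⇒≡1; n∣m*n; ∣m⇒∣m*n; ∣n⇒∣m*n; ∣m+n∣m⇒∣n;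
         %-presˡ-∣; ∣n∣m%n⇒∣m; n∣m⇒m%n≡0)
open import Data.Nat.Primality using (¬prime[0]; ¬prime[1]; euclidsLemma)
open import Data.Nat.Combinatorics
  using (nCk+nC[k+1]≡[n+1]C[k+1]; nCk≡n!/k![n-k]!; k![n∸k]!∣n!; k>n⇒nCk≡0; nCn≡1; nC1≡n)
open import Data.Product using (_,_)
open import Data.Sum using (inj₁; inj₂; [_,_]′)
open import Data.Bool using (if_then_else_)
open import Data.Empty using (⊥-elim)
open import Function using (_∘_)
open import Relation.Nullary using (¬_; yes; no; does; contradiction)
open import Relation.Binary.PropositionalEquality
  using (refl; sym; trans; cong; cong₂; subst; _≢_; module ≡-Reasoning)
open import Algebra.Properties.CommutativeSemigroup +-commutativeSemigroup
  using (x∙yz≈y∙xz; xy∙z≈xz∙y)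

open ≡-Reasoning

module _ {f g : ℕ → ℕ} where

  sumBelow-cong : ∀ n → (∀ j → j < n → f j ≡ g j) → sumBelow n f ≡ sumBelow n g
  sumBelow-cong zero    f≗g = refl
  sumBelow-cong (suc n) f≗g =
    cong₂ _+_ (sumBelow-cong n λ j j<n → f≗g j (m<n⇒m<1+n j<n)) (f≗g n (n<1+n n))

  sumBelow-+ : ∀ n → sumBelow n (λ j → f j + g j) ≡ sumBelow n f + sumBelow n g
  sumBelow-+ zero    = refl
  sumBelow-+ (suc n) = begin
    sumBelow n (λ j → f j + g j) + (f n + g n)   ≡⟨ cong (_+ (f n + g n)) (sumBelow-+ n) ⟩
    (sumBelow n f + sumBelow n g) + (f n + g n)  ≡⟨ +-assoc (sumBelow n f) _ _ ⟩
    sumBelow n f + (sumBelow n g + (f n + g n))  ≡⟨ cong (sumBelow n f +_) (x∙yz≈y∙xz _ (f n) (g n)) ⟩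
    sumBelow n f + (f n + (sumBelow n g + g n))  ≡⟨ +-assoc (sumBelow n f) (f n) _ ⟨
    (sumBelow n f + f n) + (sumBelow n g + g n)  ∎

sumBelow-const : ∀ n c → sumBelow n (λ _ → c) ≡ n * c
sumBelow-const zero    c = refl
sumBelow-const (suc n) c = trans (cong (_+ c) (sumBelow-const n c)) (+-comm (n * c) c)

sumBelow-*ˡ : ∀ n c (f : ℕ → ℕ) → sumBelow n (λ j → c * f j) ≡ c * sumBelow n f
sumBelow-*ˡ zero    c f = sym (*-zeroʳ c)
sumBelow-*ˡ (suc n) c f =
  trans (cong (_+ c * f n) (sumBelow-*ˡ n c f)) (sym (*-distribˡ-+ c (sumBelow n f) (f n)))

sumBelow-split : ∀ m n (f : ℕ → ℕ) → sumBelow (m + n) f ≡ sumBelow m f + sumBelow n (λ j → f (m + j))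
sumBelow-split m zero    f = trans (cong (λ k → sumBelow k f) (+-identityʳ m)) (sym (+-identityʳ _))
sumBelow-split m (suc n) f = begin
  sumBelow (m + suc n) f                                   ≡⟨ cong (λ k → sumBelow k f) (+-suc m n) ⟩
  sumBelow (m + n) f + f (m + n)                           ≡⟨ cong (_+ f (m + n)) (sumBelow-split m n f) ⟩
  sumBelow m f + sumBelow n (λ j → f (m + j)) + f (m + n)  ≡⟨ +-assoc (sumBelow m f) _ _ ⟩
  sumBelow m f + sumBelow (suc n) (λ j → f (m + j))        ∎

sumBelow-blocks : ∀ b l (f g h : ℕ → ℕ) → (∀ c s → c < b → s < l → f (c * l + s) ≡ g c * h s) →
                  sumBelow (b * l) f ≡ sumBelow b g * sumBelow l h
sumBelow-blocks zero    l f g h f≡gh = refl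
sumBelow-blocks (suc b) l f g h f≡gh = begin
  sumBelow (l + b * l) f                                 ≡⟨ cong (λ k → sumBelow k f) (+-comm l (b * l)) ⟩
  sumBelow (b * l + l) f                                 ≡⟨ sumBelow-split (b * l) l f ⟩
  sumBelow (b * l) f + sumBelow l (λ s → f (b * l + s))  ≡⟨ cong₂ _+_ previousBlocks lastBlock ⟩
  sumBelow b g * sumBelow l h + g b * sumBelow l h       ≡⟨ *-distribʳ-+ (sumBelow l h) (sumBelow b g) (g b) ⟨
  sumBelow (suc b) g * sumBelow l h                      ∎
  where
  previousBlocks : sumBelow (b * l) f ≡ sumBelow b g * sumBelow l h
  previousBlocks = sumBelow-blocks b l f g h λ c s c<b → f≡gh c s (m<n⇒m<1+n c<b)
  lastBlock : sumBelow l (λ s → f (b * l + s)) ≡ g b * sumBelow l h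
  lastBlock = trans (sumBelow-cong l λ s → f≡gh b s (n<1+n b)) (sumBelow-*ˡ l (g b) h)

sumBelow-single : ∀ n (f : ℕ → ℕ) i → i < n → (∀ j → j < n → j ≢ i → f j ≡ 0) → sumBelow n f ≡ f i
sumBelow-single (suc n) f i i<1+n others with m≤n⇒m<n∨m≡n (≤-pred i<1+n)
... | inj₁ i<n  = trans (cong₂ _+_ (sumBelow-single n f i i<n λ j j<n → others j (m<n⇒m<1+n j<n))
                                   (others n (n<1+n n) λ n≡i → <⇒≢ i<n (sym n≡i)))
                        (+-identityʳ (f i))
... | inj₂ refl = cong (_+ f i) (trans (sumBelow-cong n λ j j<n → others j (m<n⇒m<1+n j<n) (<⇒≢ j<n))
                                       (trans (sumBelow-const n 0) (*-zeroʳ n)))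

nonDiv : ℕ → ℕ → ℕ
nonDiv d x = if does (d ∣? x) then 0 else 1

module _ {d : ℕ} where

  nonDiv-∣ : ∀ {x} → d ∣ x → nonDiv d x ≡ 0
  nonDiv-∣ {x} d∣x with d ∣? x
  ... | yes _   = refl
  ... | no  d∤x = contradiction d∣x d∤x

  nonDiv-∤ : ∀ {x} → ¬ d ∣ x → nonDiv d x ≡ 1
  nonDiv-∤ {x} d∤x with d ∣? x
  ... | yes d∣x = contradiction d∣x d∤x
  ... | no  _   = refl

  nonDiv-cong-⇔ : ∀ {x y} → (d ∣ x → d ∣ y) → (d ∣ y → d ∣ x) → nonDiv d x ≡ nonDiv d y
  nonDiv-cong-⇔ {x} {y} to from with d ∣? x | d ∣? y
  ... | yes _   | yes _   = refl
  ... | no  _   | no  _   = refl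
  ... | yes d∣x | no  d∤y = contradiction (to d∣x) d∤y
  ... | no  d∤x | yes d∣y = contradiction (from d∣y) d∤x

  nonDiv-cong-% : ∀ .{{_ : NonZero d}} x y → x % d ≡ y % d → nonDiv d x ≡ nonDiv d y
  nonDiv-cong-% x y x≡y =
    nonDiv-cong-⇔ (λ d∣x → ∣n∣m%n⇒∣m ∣-refl (subst (d ∣_) x≡y (%-presˡ-∣ d∣x ∣-refl)))
                  (λ d∣y → ∣n∣m%n⇒∣m ∣-refl (subst (d ∣_) (sym x≡y) (%-presˡ-∣ d∣y ∣-refl)))

  countNonDiv≡sumBelow : ∀ f n → countNonDiv d f n ≡ sumBelow n (λ k → nonDiv d (f k))
  countNonDiv≡sumBelow f zero    = refl
  countNonDiv≡sumBelow f (suc n) = cong (_+ nonDiv d (f n)) (countNonDiv≡sumBelow f n)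

nonDiv-* : ∀ {p} → Prime p → ∀ x y → nonDiv p (x * y) ≡ nonDiv p x * nonDiv p y
nonDiv-* {p} p-prime x y with p ∣? x | p ∣? y
... | yes p∣x | _       = nonDiv-∣ (∣m⇒∣m*n y p∣x)
... | no  _   | yes p∣y = nonDiv-∣ (∣n⇒∣m*n x p∣y)
... | no  p∤x | no  p∤y = nonDiv-∤ λ p∣xy → [ p∤x , p∤y ]′ (euclidsLemma x y p-prime p∣xy)

rowNonDiv : ℕ → ℕ → ℕ
rowNonDiv d m = countNonDiv d (m C_) (suc m)

rowNonDiv-extend : ∀ d m {n} → suc m ≤ n → countNonDiv d (m C_) n ≡ rowNonDiv d m
rowNonDiv-extend d m = go ∘ ≤⇒≤′
  where
  go : ∀ {n} → suc m ≤′ n → countNonDiv d (m C_) n ≡ rowNonDiv d m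
  go ≤′-refl              = refl
  go (≤′-step {n} 1+m≤n) = begin
    countNonDiv d (m C_) n + nonDiv d (m C n)  ≡⟨ cong (countNonDiv d (m C_) n +_) nonDiv[mCn]≡0 ⟩
    countNonDiv d (m C_) n + 0                 ≡⟨ +-identityʳ _ ⟩
    countNonDiv d (m C_) n                     ≡⟨ go 1+m≤n ⟩
    rowNonDiv d m                              ∎
    where
    nonDiv[mCn]≡0 : nonDiv d (m C n) ≡ 0
    nonDiv[mCn]≡0 = nonDiv-∣ (subst (d ∣_) (sym (k>n⇒nCk≡0 (≤′⇒≤ 1+m≤n))) (d ∣0))

∣m+kn⇒∣m : ∀ {d m} k → d ∣ m + k * d → d ∣ m
∣m+kn⇒∣m {d} {m} k d∣m+kd = ∣m+n∣m⇒∣n (subst (d ∣_) (+-comm m (k * d)) d∣m+kd) (n∣m*n k)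

n∣m∧0<m<n+n⇒m≡n : ∀ {m n} → n ∣ m → 0 < m → m < n + n → m ≡ n
n∣m∧0<m<n+n⇒m≡n {n = n} (divides 1             refl) _ _    = +-identityʳ n
n∣m∧0<m<n+n⇒m≡n {n = n} (divides (suc (suc k)) refl) _ m<2n =
  contradiction (+-monoʳ-≤ n (m≤m+n n (k * n))) (<⇒≱ m<2n)

module _ {d : ℕ} .{{_ : NonZero d}} where

  m<n⇒[m+kn]/n≡k : ∀ {r} a → r < d → (r + a * d) / d ≡ a
  m<n⇒[m+kn]/n≡k {r} a r<d = begin
    (r + a * d) / d    ≡⟨ +-distrib-/-∣ʳ r (n∣m*n a) ⟩
    r / d + a * d / d  ≡⟨ cong₂ _+_ (m<n⇒m/n≡0 r<d) (m*n/n≡m a d) ⟩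
    a                  ∎

  private
    1+m≡1+m%n+[m/n]*n : ∀ m → suc m ≡ suc (m % d) + m / d * d
    1+m≡1+m%n+[m/n]*n m = cong suc (m≡m%n+[m/n]*n m d)

  n∣1+m⇒[1+m]/n≡1+m/n : ∀ m → d ∣ suc m → suc m / d ≡ suc (m / d)
  n∣1+m⇒[1+m]/n≡1+m/n m d∣1+m = begin
    suc m / d                      ≡⟨ cong (_/ d) (1+m≡1+m%n+[m/n]*n m) ⟩
    (suc (m % d) + m / d * d) / d  ≡⟨ cong (λ x → (x + m / d * d) / d) 1+r≡d ⟩
    (d + m / d * d) / d            ≡⟨ m*n/n≡m (suc (m / d)) d ⟩
    suc (m / d)                    ∎
    where
    d∣1+r : d ∣ suc (m % d)
    d∣1+r = ∣m+kn⇒∣m (m / d) (subst (d ∣_) (1+m≡1+m%n+[m/n]*n m) d∣1+m)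
    1+r≡d : suc (m % d) ≡ d
    1+r≡d = ≤-antisym (m%n<n m d) (∣⇒≤ d∣1+r)

  n∤1+m⇒[1+m]/n≡m/n : ∀ m → ¬ d ∣ suc m → suc m / d ≡ m / d
  n∤1+m⇒[1+m]/n≡m/n m d∤1+m with m≤n⇒m<n∨m≡n (m%n<n m d)
  ... | inj₁ 1+r<d = trans (cong (_/ d) (1+m≡1+m%n+[m/n]*n m)) (m<n⇒[m+kn]/n≡k (m / d) 1+r<d)
  ... | inj₂ 1+r≡d = contradiction (subst (d ∣_) [1+m/n]*n≡1+m (n∣m*n (suc (m / d)))) d∤1+m
    where
    [1+m/n]*n≡1+m : suc (m / d) * d ≡ suc m
    [1+m/n]*n≡1+m = sym (trans (1+m≡1+m%n+[m/n]*n m) (cong (_+ m / d * d) 1+r≡d))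

carry : (d : ℕ) .{{_ : NonZero d}} → ℕ → ℕ
carry d m = if does (d ∣? suc m) then rowNonDiv d (m / d) else 0

module _ {d : ℕ} .{{_ : NonZero d}} where

  carry-∣ : ∀ {m} → d ∣ suc m → carry d m ≡ rowNonDiv d (m / d)
  carry-∣ {m} d∣1+m with d ∣? suc m
  ... | yes _     = refl
  ... | no  d∤1+m = contradiction d∣1+m d∤1+m

  carry-∤ : ∀ {m} → ¬ d ∣ suc m → carry d m ≡ 0
  carry-∤ {m} d∤1+m with d ∣? suc m
  ... | yes d∣1+m = contradiction d∣1+m d∤1+m
  ... | no  _     = refl

  F-[1+m]/n : ∀ m → F d (suc m / d) ≡ F d (m / d) + carry d m
  F-[1+m]/n m with d ∣? suc m
  ... | yes d∣1+m = cong (F d) (n∣1+m⇒[1+m]/n≡1+m/n m d∣1+m)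
  ... | no  d∤1+m = trans (cong (F d) (n∤1+m⇒[1+m]/n≡m/n m d∤1+m)) (sym (+-identityʳ _))

  module _ (n : ℕ) where

    private
      r a j₀ : ℕ
      r = n % d
      a = n / d
      j₀ = d ∸ suc r

      n+j≡r+j+a*d : ∀ j → n + j ≡ r + j + a * d
      n+j≡r+j+a*d j = trans (cong (_+ j) (m≡m%n+[m/n]*n n d)) (xy∙z≈xz∙y r (a * d) j)

      n∣1+n+j⇒j≡j₀ : ∀ {j} → j < d → d ∣ suc (n + j) → j ≡ j₀
      n∣1+n+j⇒j≡j₀ {j} j<d d∣1+n+j = begin
        j                  ≡⟨ m+n∸m≡n (suc r) j ⟨
        suc r + j ∸ suc r  ≡⟨ cong (_∸ suc r) 1+r+j≡d ⟩
        j₀                 ∎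
        where
        d∣1+r+j : d ∣ suc (r + j)
        d∣1+r+j = ∣m+kn⇒∣m a (subst (d ∣_) (cong suc (n+j≡r+j+a*d j)) d∣1+n+j)
        1+r+j≡d : suc (r + j) ≡ d
        1+r+j≡d = n∣m∧0<m<n+n⇒m≡n d∣1+r+j (s≤s z≤n) (+-mono-≤-< (m%n<n n d) j<d)

      1+n+j₀≡[1+a]*d : suc (n + j₀) ≡ suc a * d
      1+n+j₀≡[1+a]*d =
        trans (cong suc (n+j≡r+j+a*d j₀)) (cong (_+ a * d) (m+[n∸m]≡n (m%n<n n d)))

    carry-sum : sumBelow d (λ j → (d ∸ j) * carry d (n + j)) ≡ suc (n % d) * rowNonDiv d (n / d)
    carry-sum =
      trans (sumBelow-single d _ j₀ j₀<d others) (cong₂ _*_ (m∸[m∸n]≡n (m%n<n n d)) carry-j₀)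
      where
      j₀<d : j₀ < d
      j₀<d = ∸-monoʳ-< (s≤s z≤n) (m%n<n n d)
      others : ∀ j → j < d → j ≢ j₀ → (d ∸ j) * carry d (n + j) ≡ 0
      others j j<d j≢j₀ =
        trans (cong ((d ∸ j) *_) (carry-∤ (j≢j₀ ∘ n∣1+n+j⇒j≡j₀ j<d))) (*-zeroʳ (d ∸ j))
      d∣1+n+j₀ : d ∣ suc (n + j₀)
      d∣1+n+j₀ = subst (d ∣_) (sym 1+n+j₀≡[1+a]*d) (n∣m*n (suc a))
      [n+j₀]/d≡a : (n + j₀) / d ≡ a
      [n+j₀]/d≡a = suc-injective (begin
        suc ((n + j₀) / d)  ≡⟨ n∣1+m⇒[1+m]/n≡1+m/n (n + j₀) d∣1+n+j₀ ⟨
        suc (n + j₀) / d    ≡⟨ cong (_/ d) 1+n+j₀≡[1+a]*d ⟩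
        suc a * d / d       ≡⟨ m*n/n≡m (suc a) d ⟩
        suc a               ∎)
      carry-j₀ : carry d (n + j₀) ≡ rowNonDiv d a
      carry-j₀ = trans (carry-∣ d∣1+n+j₀) (cong (rowNonDiv d) [n+j₀]/d≡a)

nCk*[k!*[n∸k]!]≡n! : ∀ {n k} → k ≤ n → (n C k) * (k ! * (n ∸ k) !) ≡ n !
nCk*[k!*[n∸k]!]≡n! {n} {k} k≤n =
  trans (cong (_* (k ! * (n ∸ k) !)) (nCk≡n!/k![n-k]! k≤n))
        (m/n*n≡m {{k !* (n ∸ k) !≢0}} (k![n∸k]!∣n! k≤n))

module _ {q : ℕ} (p-prime : Prime (suc q)) where

  -- With p = suc q, the number 0 + suc a * p reduces to suc (q + a * p), so the predecessor of a
  -- number in base-p digit form is again in digit form by pattern matching alone.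
  private
    p : ℕ
    p = suc q

  p∤m! : ∀ {m} → m < p → ¬ p ∣ m !
  p∤m! {zero}  _     p∣1   = ¬prime[1] (subst Prime (∣1⇒≡1 p∣1) p-prime)
  p∤m! {suc m} 1+m<p p∣m! with euclidsLemma (suc m) (m !) p-prime p∣m!
  ... | inj₁ p∣1+m = <⇒≱ 1+m<p (∣⇒≤ p∣1+m)
  ... | inj₂ p∣m!  = p∤m! (<⇒≤ 1+m<p) p∣m!

  p∤nCk : ∀ {n k} → k ≤ n → n < p → ¬ p ∣ n C k
  p∤nCk k≤n n<p p∣nCk = p∤m! n<p (subst (p ∣_) (nCk*[k!*[n∸k]!]≡n! k≤n) (∣m⇒∣m*n _ p∣nCk))

  p∣pCk : ∀ {k} → 0 < k → k < p → p ∣ p C k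
  p∣pCk {k} 0<k k<p with euclidsLemma (p C k) (k ! * (p ∸ k) !) p-prime p∣pCk*[k!*[p∸k]!]
    where
    p∣pCk*[k!*[p∸k]!] : p ∣ (p C k) * (k ! * (p ∸ k) !)
    p∣pCk*[k!*[p∸k]!] = subst (p ∣_) (sym (nCk*[k!*[n∸k]!]≡n! (<⇒≤ k<p))) (∣m⇒∣m*n (q !) ∣-refl)
  ... | inj₁ p∣pCk         = p∣pCk
  ... | inj₂ p∣k!*[p∸k]!   =
    ⊥-elim ([ p∤m! k<p , p∤m! (∸-monoʳ-< 0<k (<⇒≤ k<p)) ]′
              (euclidsLemma (k !) ((p ∸ k) !) p-prime p∣k!*[p∸k]!))

  private
    pascal-% : ∀ m k u v → (m C k) % p ≡ u % p → (m C suc k) % p ≡ v % p →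
               (suc m C suc k) % p ≡ (u + v) % p
    pascal-% m k u v h₁ h₂ = begin
      (suc m C suc k) % p                  ≡⟨ cong (_% p) (nCk+nC[k+1]≡[n+1]C[k+1] m k) ⟨
      (m C k + m C suc k) % p              ≡⟨ %-distribˡ-+ (m C k) (m C suc k) p ⟩
      ((m C k) % p + (m C suc k) % p) % p  ≡⟨ cong₂ (λ x y → (x + y) % p) h₁ h₂ ⟩
      (u % p + v % p) % p                  ≡⟨ %-distribˡ-+ u v p ⟨
      (u + v) % p                          ∎

    q<p : q < p
    q<p = n<1+n q

    0<p : 0 < p
    0<p = s≤s z≤n

  lucas : ∀ a r c s → r < p → s < p → ((r + a * p) C (s + c * p)) % p ≡ ((a C c) * (r C s)) % p
  lucas a       r       zero    zero    _     _     = refl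
  lucas zero    zero    (suc c) zero    _     _     = refl
  lucas zero    zero    c       (suc s) _     _     = cong (_% p) (sym (*-zeroʳ (0 C c)))
  lucas a       (suc r) c       (suc s) 1+r<p 1+s<p = begin
    (suc (r + a * p) C suc (s + c * p)) % p
      ≡⟨ pascal-% (r + a * p) (s + c * p) ((a C c) * (r C s)) ((a C c) * (r C suc s))
                  (lucas a r c s (<⇒≤ 1+r<p) (<⇒≤ 1+s<p)) (lucas a r c (suc s) (<⇒≤ 1+r<p) 1+s<p) ⟩
    ((a C c) * (r C s) + (a C c) * (r C suc s)) % p
      ≡⟨ cong (_% p) (*-distribˡ-+ (a C c) (r C s) (r C suc s)) ⟨
    ((a C c) * (r C s + r C suc s)) % p
      ≡⟨ cong (λ x → ((a C c) * x) % p) (nCk+nC[k+1]≡[n+1]C[k+1] r s) ⟩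
    ((a C c) * (suc r C suc s)) % p
      ∎
  lucas a       (suc r) (suc c) zero    1+r<p _     = begin
    (suc (r + a * p) C suc (q + c * p)) % p
      ≡⟨ pascal-% (r + a * p) (q + c * p) ((a C c) * (r C q)) ((a C suc c) * 1)
                  (lucas a r c q (<⇒≤ 1+r<p) q<p) (lucas a r (suc c) zero (<⇒≤ 1+r<p) 0<p) ⟩
    ((a C c) * (r C q) + (a C suc c) * 1) % p
      ≡⟨ cong (λ x → ((a C c) * x + (a C suc c) * 1) % p) (k>n⇒nCk≡0 (≤-pred 1+r<p)) ⟩
    ((a C c) * 0 + (a C suc c) * 1) % p
      ≡⟨ cong (λ x → (x + (a C suc c) * 1) % p) (*-zeroʳ (a C c)) ⟩
    ((a C suc c) * 1) % p
      ∎
  lucas (suc a) zero    c       (suc s) _     1+s<p = begin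
    (suc (q + a * p) C suc (s + c * p)) % p
      ≡⟨ pascal-% (q + a * p) (s + c * p) ((a C c) * (q C s)) ((a C c) * (q C suc s))
                  (lucas a q c s q<p (<⇒≤ 1+s<p)) (lucas a q c (suc s) q<p 1+s<p) ⟩
    ((a C c) * (q C s) + (a C c) * (q C suc s)) % p
      ≡⟨ cong (_% p) (*-distribˡ-+ (a C c) (q C s) (q C suc s)) ⟨
    ((a C c) * (q C s + q C suc s)) % p
      ≡⟨ cong (λ x → ((a C c) * x) % p) (nCk+nC[k+1]≡[n+1]C[k+1] q s) ⟩
    ((a C c) * (p C suc s)) % p
      ≡⟨ n∣m⇒m%n≡0 _ p (∣n⇒∣m*n (a C c) (p∣pCk (s≤s z≤n) 1+s<p)) ⟩
    0
      ≡⟨ cong (_% p) (*-zeroʳ (suc a C c)) ⟨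
    ((suc a C c) * 0) % p
      ∎
  lucas (suc a) zero    (suc c) zero    _     _     = begin
    (suc (q + a * p) C suc (q + c * p)) % p
      ≡⟨ pascal-% (q + a * p) (q + c * p) ((a C c) * (q C q)) ((a C suc c) * 1)
                  (lucas a q c q q<p q<p) (lucas a q (suc c) zero q<p 0<p) ⟩
    ((a C c) * (q C q) + (a C suc c) * 1) % p
      ≡⟨ cong (λ x → ((a C c) * x + (a C suc c) * 1) % p) (nCn≡1 q) ⟩
    ((a C c) * 1 + (a C suc c) * 1) % p
      ≡⟨ cong (_% p) (*-distribʳ-+ 1 (a C c) (a C suc c)) ⟨
    ((a C c + a C suc c) * 1) % p
      ≡⟨ cong (λ x → (x * 1) % p) (nCk+nC[k+1]≡[n+1]C[k+1] a c) ⟩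
    ((suc a C suc c) * 1) % p
      ∎

  rowNonDiv-small : ∀ {m} → m < p → rowNonDiv p m ≡ suc m
  rowNonDiv-small {m} m<p = begin
    rowNonDiv p m                              ≡⟨ countNonDiv≡sumBelow (m C_) (suc m) ⟩
    sumBelow (suc m) (λ k → nonDiv p (m C k))
      ≡⟨ sumBelow-cong (suc m) (λ k k≤m → nonDiv-∤ (p∤nCk (≤-pred k≤m) m<p)) ⟩
    sumBelow (suc m) (λ _ → 1)                 ≡⟨ sumBelow-const (suc m) 1 ⟩
    suc m * 1                                  ≡⟨ *-identityʳ (suc m) ⟩
    suc m                                      ∎

  rowNonDiv-digits : ∀ a {r} → r < p → rowNonDiv p (r + a * p) ≡ suc r * rowNonDiv p a
  rowNonDiv-digits a {r} r<p = begin
    rowNonDiv p (r + a * p)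
      ≡⟨ rowNonDiv-extend p (r + a * p) (+-monoˡ-≤ (a * p) r<p) ⟨
    countNonDiv p ((r + a * p) C_) (suc a * p)
      ≡⟨ countNonDiv≡sumBelow ((r + a * p) C_) (suc a * p) ⟩
    sumBelow (suc a * p) (λ k → nonDiv p ((r + a * p) C k))
      ≡⟨ sumBelow-blocks (suc a) p _ (λ c → nonDiv p (a C c)) (λ s → nonDiv p (r C s)) digitwise ⟩
    sumBelow (suc a) (λ c → nonDiv p (a C c)) * sumBelow p (λ s → nonDiv p (r C s))
      ≡⟨ cong₂ _*_ (countNonDiv≡sumBelow (a C_) (suc a)) (countNonDiv≡sumBelow (r C_) p) ⟨
    rowNonDiv p a * countNonDiv p (r C_) p
      ≡⟨ cong (rowNonDiv p a *_) (trans (rowNonDiv-extend p r r<p) (rowNonDiv-small r<p)) ⟩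
    rowNonDiv p a * suc r
      ≡⟨ *-comm (rowNonDiv p a) (suc r) ⟩
    suc r * rowNonDiv p a
      ∎
    where
    digitwise : ∀ c s → c < suc a → s < p →
                nonDiv p ((r + a * p) C (c * p + s)) ≡ nonDiv p (a C c) * nonDiv p (r C s)
    digitwise c s _ s<p = begin
      nonDiv p ((r + a * p) C (c * p + s))  ≡⟨ cong (λ k → nonDiv p ((r + a * p) C k)) (+-comm (c * p) s) ⟩
      nonDiv p ((r + a * p) C (s + c * p))
        ≡⟨ nonDiv-cong-% ((r + a * p) C (s + c * p)) ((a C c) * (r C s)) (lucas a r c s r<p s<p) ⟩
      nonDiv p ((a C c) * (r C s))          ≡⟨ nonDiv-* p-prime (a C c) (r C s) ⟩
      nonDiv p (a C c) * nonDiv p (r C s)   ∎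

  F-triangular : ∀ j → j ≤ p → F p j ≡ suc j C 2
  F-triangular zero    _   = refl
  F-triangular (suc j) j<p = begin
    F p j + rowNonDiv p j  ≡⟨ cong₂ _+_ (F-triangular j (<⇒≤ j<p)) (rowNonDiv-small j<p) ⟩
    suc j C 2 + suc j      ≡⟨ +-comm (suc j C 2) (suc j) ⟩
    suc j + suc j C 2      ≡⟨ cong (_+ suc j C 2) (nC1≡n (suc j)) ⟨
    suc j C 1 + suc j C 2  ≡⟨ nCk+nC[k+1]≡[n+1]C[k+1] (suc j) 1 ⟩
    suc (suc j) C 2        ∎

  F-recurrence : ∀ n → F p n ≡ sumBelow p (λ j → (p ∸ j) * F p ((n + j) / p))
  F-recurrence zero = sym (begin
    sumBelow p (λ j → (p ∸ j) * F p (j / p))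
      ≡⟨ sumBelow-cong p (λ j j<p → cong (λ x → (p ∸ j) * F p x) (m<n⇒m/n≡0 j<p)) ⟩
    sumBelow p (λ j → (p ∸ j) * 0)            ≡⟨ sumBelow-cong p (λ j _ → *-zeroʳ (p ∸ j)) ⟩
    sumBelow p (λ _ → 0)                      ≡⟨ sumBelow-const p 0 ⟩
    p * 0                                     ≡⟨ *-zeroʳ p ⟩
    0                                         ∎)
  F-recurrence (suc n) = begin
    F p n + rowNonDiv p n
      ≡⟨ cong₂ _+_ (F-recurrence n) rowNonDiv-n ⟩
    S n + suc (n % p) * rowNonDiv p (n / p)
      ≡⟨ cong (S n +_) (carry-sum n) ⟨
    S n + sumBelow p (λ j → (p ∸ j) * carry p (n + j))
      ≡⟨ sumBelow-+ p ⟨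
    sumBelow p (λ j → (p ∸ j) * F p ((n + j) / p) + (p ∸ j) * carry p (n + j))
      ≡⟨ sumBelow-cong p (λ j _ → trans (cong ((p ∸ j) *_) (F-[1+m]/n (n + j))) (*-distribˡ-+ (p ∸ j) _ _)) ⟨
    S (suc n)
      ∎
    where
    S : ℕ → ℕ
    S n = sumBelow p (λ j → (p ∸ j) * F p ((n + j) / p))
    rowNonDiv-n : rowNonDiv p n ≡ suc (n % p) * rowNonDiv p (n / p)
    rowNonDiv-n = trans (cong (rowNonDiv p) (m≡m%n+[m/n]*n n p)) (rowNonDiv-digits (n / p) (m%n<n n p))

theorem2p1 : (p : ℕ) → (pr : Prime p) → .{{_ : NonZero p}} →
    ((j : ℕ) → 1 ≤ j → j ≤ p ∸ 1 → F p j ≡ (j + 1) C 2)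
    × ((n : ℕ) → F p n ≡ sumBelow p (λ j → (p ∸ j) * F p ((n + j) / p)))
theorem2p1 zero    pr = contradiction pr ¬prime[0]
theorem2p1 (suc q) pr =
  (λ j _ j≤q → trans (F-triangular pr j (m≤n⇒m≤1+n j≤q)) (cong (_C 2) (+-comm 1 j))) ,
  F-recurrence pr
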